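{- Let $k\geq 2$, let $H$ be a $k$-partite $k$-uniform hypergraph with partition $V(H)=V_1\cup\cdots\cup V_k$, let $q_1,\dots,q_k$ be positive integers, and let $L:V(H)\to 2^{\mathbb{N}}$ be a list assignment with $|L(u)|=q_i$ for every $i\in[k]$ and $u\in V_i$. Fix $j\in[k]$ and let $\phi$ be the random partial coloring obtained by choosing, independently for each $u\in V(H)\setminus V_j$, a color $\phi(u)\in L(u)$ uniformly at random (vertices of $V_j$ are left uncolored). For $v\in V_j$ let \[L_\phi(v)=\{c\in L(v): \text{for every } e\in E_H(v,c),\ \{\phi(u):u\in e\setminus\{v\}\}\neq\{c\}\}.\] Then for each $v\in V_j$, \[\mathbb{P}[L_\phi(v)=\emptyset]\leq\left(1-\left(1-\prod_{i\in[k]\setminus\{j\}}q_i^{ -1}\right)^{\sum_{c\in L(v)}\deg_H(v,c)/q_j}\right)^{q_j}.\]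
   Context: A $k$-uniform hypergraph is $k$-partite with partition $V_1,\dots,V_k$ if every edge contains exactly one vertex of each $V_i$. For a list assignment $L$, a vertex $v$ and color $c$, $E_H(v,c)$ is the set of edges $e$ containing $v$ such that $c\in L(u)$ for every $u\in e$, and $\deg_H(v,c)=|E_H(v,c)|$. -}

module Defs where

open import Data.Nat as ℕ using (ℕ; zero; suc)
open import Data.Fin using (Fin; zero; suc)
open import Data.Fin.Properties using () renaming (_≟_ to _≟ᶠ_)
open import Data.Vec using (Vec; lookup; toList)
open import Data.List using (List; []; _∷_; [_]; length; map; concatMap; filter; allFin)
open import Data.Nat.ListAction using (product)
open import Data.List.Relation.Unary.All using (All)
open import Data.List.Relation.Unary.All.Properties using ()
open import Data.List.Relation.Unary.Any using (Any)
import Data.List.Relation.Unary.All as All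
import Data.List.Relation.Unary.Any as Any
open import Data.List.Membership.DecPropositional (ℕ._≟_) using () renaming (_∈?_ to _∈ℕ?_)
open import Relation.Binary.PropositionalEquality using (_≡_)
open import Relation.Nullary using (¬_; ¬?; _⊎-dec_; Dec)
open import Data.Sum using (_⊎_)
import Data.Rational as ℚ
open ℚ using (ℚ)
open import Data.Integer using (+_)

-- Hypergraphs on vertex set Fin n, with a k-partition  part : Fin n → Fin k.
-- An edge of a k-uniform k-partite hypergraph is a vector of k vertices
-- whose i-th entry lies in V_i (so each edge has exactly one vertex of
-- each part).  The edge set is a duplicate-free list of such vectors.

Edge : ℕ → ℕ → Set
Edge n k = Vec (Fin n) k

IsKPartite : ∀ {n k} → (Fin n → Fin k) → List (Edge n k) → Set
IsKPartite part edges = All (λ e → ∀ i → part (lookup e i) ≡ i) edges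

ListAssignment : ℕ → Set
ListAssignment n = Fin n → List ℕ

module _ {n k : ℕ} (edges : List (Edge n k)) (L : ListAssignment n) where

  open import Data.List.Membership.DecPropositional (_≟ᶠ_ {n}) using () renaming (_∈?_ to _∈ᶠ?_)

  E : Fin n → ℕ → List (Edge n k)
  E v c = filter (λ e → (v ∈ᶠ? toList e)
                   Relation.Nullary.×-dec
                   All.all? (λ u → c ∈ℕ? L u) (toList e)) edges

  deg : Fin n → ℕ → ℕ
  deg v c = length (E v c)

  Coloring : Set
  Coloring = (u : Fin n) → Fin (length (L u))

  colour : Coloring → Fin n → ℕ
  colour φ u = Data.List.lookup (L u) (φ u)

  -- {φ(u) : u ∈ e ∖ {v}} = {c}, i.e. every u ∈ e other than v has colour c
  -- (e ∖ {v} is nonempty in our setting since k ≥ 2)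
  Blocks? : (φ : Coloring) (v : Fin n) (c : ℕ) (e : Edge n k) →
            Dec (All (λ u → u ≡ v ⊎ colour φ u ≡ c) (toList e))
  Blocks? φ v c e = All.all? (λ u → (u ≟ᶠ v) ⊎-dec (colour φ u ℕ.≟ c)) (toList e)

  Lφ : Coloring → Fin n → List ℕ
  Lφ φ v = filter (λ c → ¬? (Any.any? (Blocks? φ v c) (E v c))) (L v)

-- Enumeration of all dependent choice functions (i : Fin m) → Fin (f i).
-- Counting over this list realises the uniform product probability space.

consF : ∀ {m} {f : Fin (suc m) → ℕ} → Fin (f zero) →
        ((i : Fin m) → Fin (f (suc i))) → (i : Fin (suc m)) → Fin (f i)
consF a g zero    = a
consF a g (suc i) = g i

allChoices : (m : ℕ) (f : Fin m → ℕ) → List ((i : Fin m) → Fin (f i))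
allChoices zero    f = [ (λ ()) ]
allChoices (suc m) f =
  concatMap (λ a → map (λ g → consF {f = f} a g) (allChoices m (λ i → f (suc i))))
            (allFin (f zero))

badCount : ∀ {n k} (edges : List (Edge n k)) (L : ListAssignment n) → Fin n → ℕ
badCount {n} edges L v =
  length (filter (λ φ → length (Lφ edges L φ v) ℕ.≟ 0) (allChoices n (λ u → length (L u))))

totalCount : ∀ {n} (L : ListAssignment n) → ℕ
totalCount {n} L = length (allChoices n (λ u → length (L u)))

prodExcept : ∀ {k} → (Fin k → ℕ) → Fin k → ℕ
prodExcept {k} q j = product (map q (filter (λ i → ¬? (i ≟ᶠ j)) (allFin k)))

_^ℚ_ : ℚ → ℕ → ℚ
x ^ℚ zero  = ℚ.1ℚ
x ^ℚ suc m = x ℚ.* (x ^ℚ m)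

ℕ→ℚ : ℕ → ℚ
ℕ→ℚ m = + m ℚ./ 1

-- A colour c ∈ L v is lost
-- when some e ∈ E_H(v,c) has e ∖ {v} monochromatic in c, an event of probability
-- w = 1/P with P = ∏_{i≠j} q_i.  Conditioning on the colour of one vertex at a
-- time shows that all of L v is lost with probability at most
-- ∏_{c ∈ L v} (1 - (1 - w)^deg(v,c)): for a fixed colour the sets e ∖ {v} behave
-- at worst as if independent, and the events for different colours are
-- negatively correlated because a vertex receives only one colour.  With
-- a_c = (1 - w)^deg(v,c), AM-GM bounds the geometric means of the 1 - a_c and of
-- the a_c by their arithmetic means, which sum to 1.

module Submission where

open import Defs
open import Data.Nat using (ℕ; _≤_; _∸_)
open import Data.Fin using (Fin)
open import Data.List using (List; length; map)
open import Data.Nat.ListAction using (sum)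
open import Data.List.Relation.Unary.Unique.Propositional using (Unique)
open import Relation.Binary.PropositionalEquality using (_≡_)
open import Data.Rational using (ℚ; 0ℚ; 1ℚ; _+_; _*_) renaming (_≤_ to _≤ℚ_)

open import Data.Bool using (Bool; true; false; not; if_then_else_; T; T?)
open import Data.Bool.Properties using (if-float)
open import Data.Empty using (⊥-elim)
open import Data.Fin using (zero; suc)
open import Data.Fin.Properties using () renaming (_≟_ to _≟ᶠ_)
import Data.Integer as ℤ
import Data.Integer.Properties as ℤ
open import Data.List using ([]; _∷_; _++_; foldr; filter; filterᵇ; lookup; concatMap; allFin)
open import Data.List.Membership.Propositional using (find; lose)
open import Data.List.Properties
  using (length-map; length-++; length-tabulate; map-∘; map-cong; map-cong-local; map-tabulate; tabulate-lookup; filter-++)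
open import Data.List.Relation.Unary.All using (All; []; _∷_; universal)
import Data.List.Relation.Unary.All as All
open import Data.List.Relation.Unary.All.Properties using (map⁺; all-filter)
import Data.List.Relation.Unary.All.Properties as All
open import Data.List.Relation.Unary.AllPairs using ([]; _∷_)
open import Data.List.Relation.Unary.Any using (Any)
import Data.List.Relation.Unary.Any as Any
import Data.List.Relation.Unary.Any.Properties as AnyP
open import Data.List.Relation.Unary.Any.Properties using (lookup-result)
import Data.List.Relation.Unary.Unique.Propositional.Properties as Unique
open import Data.List.Relation.Unary.Unique.Propositional.Properties using (allFin⁺)
open import Data.Nat as ℕ using (zero; suc; z≤n; s≤s)
open import Data.Nat.ListAction using (product)
import Data.Nat.Properties as ℕ
open import Data.Product using (_×_; _,_; proj₁; proj₂)
open import Data.Rational using (toℚᵘ; _-_; _<_; 1/_; positive; nonNegative)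
open import Data.Rational.Properties
  using ( ≤-refl; ≤-reflexive; ≤-trans; ≤-antisym; ≤-total; <-≤-trans; <⇒≤; <-irrefl; ≮⇒≥; ≰⇒>; _≤?_; _<?_
        ; +-mono-≤; +-monoʳ-≤; +-monoˡ-≤; +-identityʳ; +-inverseʳ
        ; *-identityˡ; *-identityʳ; *-zeroˡ; *-zeroʳ; *-assoc; *-comm; *-distribˡ-+; *-inverseʳ
        ; *-monoˡ-≤-nonNeg; *-monoʳ-≤-nonNeg; *-cancelˡ-≤-pos
        ; positive⁻¹; nonNegative⁻¹; normalize-pos; normalize-nonNeg; pos⇒nonZero; pos⇒nonNeg; 1/pos⇒pos
        ; nonNeg*nonNeg⇒nonNeg; pos*pos⇒pos; toℚᵘ-injective; toℚᵘ-fromℚᵘ; toℚᵘ-homo-+; toℚᵘ-homo-*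
        ; module ≤-Reasoning )
open import Data.Rational.Solver using (module +-*-Solver)
import Data.Rational.Unnormalised as ℚᵘ
import Data.Rational.Unnormalised.Properties as ℚᵘ
open import Data.Sum using (_⊎_; inj₁; inj₂)
open import Data.Unit using (tt)
open import Data.Vec using (toList)
import Data.Vec as Vec
open import Data.Vec.Membership.Propositional.Properties using (∈-lookup; ∈-toList⁺)
open import Function using (_∘_; id)
open import Relation.Binary.PropositionalEquality using (_≢_; ≢-sym; refl; sym; trans; cong; cong₂; subst)
open import Relation.Nullary using (yes; no; does; ¬?)
open import Relation.Nullary.Decidable using (dec-true; dec-false)
open import Relation.Unary using (Decidable)

open +-*-Solver using (solve; _:+_; _:-_; _:*_; _:=_; con)
open ≤-Reasoning

private
  ℕ→ℚᵘ : ℕ → ℚᵘ.ℚᵘ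
  ℕ→ℚᵘ m = ℚᵘ.mkℚᵘ (ℤ.+ m) 0

  toℚᵘ-ℕ→ℚ : ∀ m → toℚᵘ (ℕ→ℚ m) ℚᵘ.≃ ℕ→ℚᵘ m
  toℚᵘ-ℕ→ℚ m = toℚᵘ-fromℚᵘ (ℕ→ℚᵘ m)

  ℕ→ℚᵘ-+ : ∀ a b → ℕ→ℚᵘ (a ℕ.+ b) ℚᵘ.≃ ℕ→ℚᵘ a ℚᵘ.+ ℕ→ℚᵘ b
  ℕ→ℚᵘ-+ a b = ℚᵘ.*≡* (trans (ℤ.*-identityʳ _) (sym (trans (ℤ.*-identityʳ _)
    (trans (cong₂ ℤ._+_ (ℤ.*-identityʳ (ℤ.+ a)) (ℤ.*-identityʳ (ℤ.+ b))) (sym (ℤ.pos-+ a b))))))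

  ℕ→ℚᵘ-* : ∀ a b → ℕ→ℚᵘ (a ℕ.* b) ℚᵘ.≃ ℕ→ℚᵘ a ℚᵘ.* ℕ→ℚᵘ b
  ℕ→ℚᵘ-* a b = ℚᵘ.*≡* (trans (ℤ.*-identityʳ _) (sym (trans (ℤ.*-identityʳ _) (sym (ℤ.pos-* a b)))))

ℕ→ℚ-+ : ∀ a b → ℕ→ℚ (a ℕ.+ b) ≡ ℕ→ℚ a + ℕ→ℚ b
ℕ→ℚ-+ a b = toℚᵘ-injective
  (ℚᵘ.≃-trans (toℚᵘ-ℕ→ℚ (a ℕ.+ b)) (ℚᵘ.≃-trans (ℕ→ℚᵘ-+ a b) (ℚᵘ.≃-sym
    (ℚᵘ.≃-trans (toℚᵘ-homo-+ (ℕ→ℚ a) (ℕ→ℚ b)) (ℚᵘ.+-cong (toℚᵘ-ℕ→ℚ a) (toℚᵘ-ℕ→ℚ b))))))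

ℕ→ℚ-* : ∀ a b → ℕ→ℚ (a ℕ.* b) ≡ ℕ→ℚ a * ℕ→ℚ b
ℕ→ℚ-* a b = toℚᵘ-injective
  (ℚᵘ.≃-trans (toℚᵘ-ℕ→ℚ (a ℕ.* b)) (ℚᵘ.≃-trans (ℕ→ℚᵘ-* a b) (ℚᵘ.≃-sym
    (ℚᵘ.≃-trans (toℚᵘ-homo-* (ℕ→ℚ a) (ℕ→ℚ b)) (ℚᵘ.*-cong (toℚᵘ-ℕ→ℚ a) (toℚᵘ-ℕ→ℚ b))))))

0≤q-p⇒p≤q : ∀ {p q} → 0ℚ ≤ℚ q - p → p ≤ℚ q
0≤q-p⇒p≤q {p} {q} 0≤q-p = begin
  p            ≡⟨ +-identityʳ p ⟨
  p + 0ℚ       ≤⟨ +-monoʳ-≤ p 0≤q-p ⟩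
  p + (q - p)  ≡⟨ solve 2 (λ p q → p :+ (q :- p) := q) refl p q ⟩
  q            ∎

p≤q⇒0≤q-p : ∀ {p q} → p ≤ℚ q → 0ℚ ≤ℚ q - p
p≤q⇒0≤q-p {p} {q} p≤q = begin
  0ℚ      ≡⟨ +-inverseʳ p ⟨
  p - p   ≤⟨ +-monoˡ-≤ (Data.Rational.- p) p≤q ⟩
  q - p   ∎

-- Polynomial inequalities are proved by exhibiting q - p as a manifestly
-- nonnegative expression, the identity being checked by the ring solver.
≤-by-difference : ∀ {p q r} → 0ℚ ≤ℚ r → q - p ≡ r → p ≤ℚ q
≤-by-difference 0≤r q-p≡r = 0≤q-p⇒p≤q (subst (0ℚ ≤ℚ_) (sym q-p≡r) 0≤r)

0≤* : ∀ {p q} → 0ℚ ≤ℚ p → 0ℚ ≤ℚ q → 0ℚ ≤ℚ p * q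
0≤* {p} {q} 0≤p 0≤q =
  nonNegative⁻¹ (p * q) {{nonNeg*nonNeg⇒nonNeg p {{nonNegative 0≤p}} q {{nonNegative 0≤q}}}}

0<* : ∀ {p q} → 0ℚ < p → 0ℚ < q → 0ℚ < p * q
0<* {p} {q} 0<p 0<q = positive⁻¹ (p * q) {{pos*pos⇒pos p {{positive 0<p}} q {{positive 0<q}}}}

*-monoˡ-≤-0≤ : ∀ {r p q} → 0ℚ ≤ℚ r → p ≤ℚ q → r * p ≤ℚ r * q
*-monoˡ-≤-0≤ {r} 0≤r = *-monoˡ-≤-nonNeg r {{nonNegative 0≤r}}

*-monoʳ-≤-0≤ : ∀ {r p q} → 0ℚ ≤ℚ r → p ≤ℚ q → p * r ≤ℚ q * r
*-monoʳ-≤-0≤ {r} 0≤r = *-monoʳ-≤-nonNeg r {{nonNegative 0≤r}}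

*-mono-≤-0≤ : ∀ {p q r s} → 0ℚ ≤ℚ q → 0ℚ ≤ℚ r → p ≤ℚ q → r ≤ℚ s → p * r ≤ℚ q * s
*-mono-≤-0≤ {p} {q} {r} {s} 0≤q 0≤r p≤q r≤s = begin
  p * r  ≤⟨ *-monoʳ-≤-0≤ 0≤r p≤q ⟩
  q * r  ≤⟨ *-monoˡ-≤-0≤ 0≤q r≤s ⟩
  q * s  ∎

*-cancelˡ-≤-0< : ∀ {r p q} → 0ℚ < r → r * p ≤ℚ r * q → p ≤ℚ q
*-cancelˡ-≤-0< {r} 0<r = *-cancelˡ-≤-pos r {{positive 0<r}}

p*r≤r*q⇒p≤q : ∀ {p q r} → 0ℚ < r → p * r ≤ℚ r * q → p ≤ℚ q
p*r≤r*q⇒p≤q {p} {q} {r} 0<r pr≤rq = *-cancelˡ-≤-0< 0<r (≤-trans (≤-reflexive (*-comm r p)) pr≤rq)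

0≤ℕ→ℚ : ∀ m → 0ℚ ≤ℚ ℕ→ℚ m
0≤ℕ→ℚ m = nonNegative⁻¹ (ℕ→ℚ m) {{normalize-nonNeg m 1}}

0<ℕ→ℚ : ∀ {m} → 1 ≤ m → 0ℚ < ℕ→ℚ m
0<ℕ→ℚ {suc m} _ = positive⁻¹ (ℕ→ℚ (suc m)) {{normalize-pos (suc m) 1}}

ℕ→ℚ-mono-≤ : ∀ {a b} → a ≤ b → ℕ→ℚ a ≤ℚ ℕ→ℚ b
ℕ→ℚ-mono-≤ {a} {b} a≤b = ≤-by-difference (0≤ℕ→ℚ (b ∸ a)) (begin-equality
  ℕ→ℚ b - ℕ→ℚ a                  ≡⟨ cong (λ c → ℕ→ℚ c - ℕ→ℚ a) (ℕ.m+[n∸m]≡n a≤b) ⟨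
  ℕ→ℚ (a ℕ.+ (b ∸ a)) - ℕ→ℚ a    ≡⟨ cong (_- ℕ→ℚ a) (ℕ→ℚ-+ a (b ∸ a)) ⟩
  ℕ→ℚ a + ℕ→ℚ (b ∸ a) - ℕ→ℚ a    ≡⟨ solve 2 (λ a d → a :+ d :- a := d) refl (ℕ→ℚ a) (ℕ→ℚ (b ∸ a)) ⟩
  ℕ→ℚ (b ∸ a)                    ∎)

-- 1/ℕ 0 = 0 is a junk value; lemmas using 1/ℕ m as an inverse assume 1 ≤ m.
1/ℕ : ℕ → ℚ
1/ℕ zero    = 0ℚ
1/ℕ (suc m) = (1/ ℕ→ℚ (suc m)) {{pos⇒nonZero (ℕ→ℚ (suc m)) {{normalize-pos (suc m) 1}}}}

ℕ→ℚ*1/ℕ : ∀ {m} → 1 ≤ m → ℕ→ℚ m * 1/ℕ m ≡ 1ℚ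
ℕ→ℚ*1/ℕ {suc m} _ = *-inverseʳ (ℕ→ℚ (suc m)) {{pos⇒nonZero (ℕ→ℚ (suc m)) {{normalize-pos (suc m) 1}}}}

0≤1/ℕ : ∀ m → 0ℚ ≤ℚ 1/ℕ m
0≤1/ℕ zero    = ≤-refl
0≤1/ℕ (suc m) = nonNegative⁻¹ (1/ℕ (suc m))
  {{pos⇒nonNeg (1/ℕ (suc m)) {{1/pos⇒pos (ℕ→ℚ (suc m)) {{normalize-pos (suc m) 1}}}}}}

1/ℕ≤1 : ∀ m → 1/ℕ m ≤ℚ 1ℚ
1/ℕ≤1 zero    = 0≤ℕ→ℚ 1
1/ℕ≤1 (suc m) = begin
  1/ℕ (suc m)                 ≡⟨ *-identityˡ _ ⟨
  1ℚ * 1/ℕ (suc m)            ≤⟨ *-monoʳ-≤-0≤ (0≤1/ℕ (suc m)) (ℕ→ℚ-mono-≤ {1} {suc m} (s≤s z≤n)) ⟩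
  ℕ→ℚ (suc m) * 1/ℕ (suc m)   ≡⟨ ℕ→ℚ*1/ℕ {suc m} (s≤s z≤n) ⟩
  1ℚ                          ∎

1/ℕ-* : ∀ {a b} → 1 ≤ a → 1 ≤ b → 1/ℕ (a ℕ.* b) ≡ 1/ℕ a * 1/ℕ b
1/ℕ-* {a} {b} 1≤a 1≤b = begin-equality
  i                                ≡⟨ solve 1 (λ i → i := i :* (con 1ℚ :* con 1ℚ)) refl i ⟩
  i * (1ℚ * 1ℚ)                    ≡⟨ cong (i *_) (cong₂ _*_ (ℕ→ℚ*1/ℕ 1≤a) (ℕ→ℚ*1/ℕ 1≤b)) ⟨
  i * (A * x * (B * y))            ≡⟨ solve 5 (λ i A x B y → i :* (A :* x :* (B :* y)) := (A :* B :* i) :* (x :* y))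
                                             refl i A x B y ⟩
  A * B * i * (x * y)              ≡⟨ cong (λ z → z * i * (x * y)) (ℕ→ℚ-* a b) ⟨
  ℕ→ℚ (a ℕ.* b) * i * (x * y)      ≡⟨ cong (_* (x * y)) (ℕ→ℚ*1/ℕ (ℕ.*-mono-≤ 1≤a 1≤b)) ⟩
  1ℚ * (x * y)                     ≡⟨ *-identityˡ (x * y) ⟩
  x * y                            ∎
  where
  A = ℕ→ℚ a
  B = ℕ→ℚ b
  i = 1/ℕ (a ℕ.* b)
  x = 1/ℕ a
  y = 1/ℕ b

ℕ→ℚ-∸1 : ∀ {p} → 1 ≤ p → ℕ→ℚ (p ∸ 1) ≡ ℕ→ℚ p * (1ℚ - 1/ℕ p)
ℕ→ℚ-∸1 {suc p} 1≤p = sym (begin-equality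
  P * (1ℚ - 1/ℕ (suc p))       ≡⟨ solve 2 (λ P i → P :* (con 1ℚ :- i) := P :- P :* i) refl P (1/ℕ (suc p)) ⟩
  P - P * 1/ℕ (suc p)          ≡⟨ cong₂ _-_ (ℕ→ℚ-+ 1 p) (ℕ→ℚ*1/ℕ 1≤p) ⟩
  1ℚ + ℕ→ℚ p - 1ℚ              ≡⟨ solve 1 (λ N → con 1ℚ :+ N :- con 1ℚ := N) refl (ℕ→ℚ p) ⟩
  ℕ→ℚ p                        ∎)
  where P = ℕ→ℚ (suc p)

_∈[0,1] : ℚ → Set
p ∈[0,1] = 0ℚ ≤ℚ p × p ≤ℚ 1ℚ

∈[0,1]-* : ∀ {p q} → p ∈[0,1] → q ∈[0,1] → (p * q) ∈[0,1]
∈[0,1]-* (0≤p , p≤1) (0≤q , q≤1) = 0≤* 0≤p 0≤q , *-mono-≤-0≤ (0≤ℕ→ℚ 1) 0≤q p≤1 q≤1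

1-∈[0,1] : ∀ {p} → p ∈[0,1] → (1ℚ - p) ∈[0,1]
1-∈[0,1] {p} (0≤p , p≤1) =
  p≤q⇒0≤q-p p≤1 , ≤-by-difference 0≤p (solve 1 (λ p → con 1ℚ :- (con 1ℚ :- p) := p) refl p)

0≤^ℚ : ∀ {x} m → 0ℚ ≤ℚ x → 0ℚ ≤ℚ x ^ℚ m
0≤^ℚ zero    0≤x = 0≤ℕ→ℚ 1
0≤^ℚ (suc m) 0≤x = 0≤* 0≤x (0≤^ℚ m 0≤x)

0<^ℚ : ∀ {x} m → 0ℚ < x → 0ℚ < x ^ℚ m
0<^ℚ zero    0<x = 0<ℕ→ℚ {1} (s≤s z≤n)
0<^ℚ (suc m) 0<x = 0<* 0<x (0<^ℚ m 0<x)

^ℚ-monoˡ-≤ : ∀ {x y} m → 0ℚ ≤ℚ x → x ≤ℚ y → x ^ℚ m ≤ℚ y ^ℚ m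
^ℚ-monoˡ-≤ zero    0≤x x≤y = ≤-refl
^ℚ-monoˡ-≤ (suc m) 0≤x x≤y = *-mono-≤-0≤ (≤-trans 0≤x x≤y) (0≤^ℚ m 0≤x) x≤y (^ℚ-monoˡ-≤ m 0≤x x≤y)

^ℚ-∈[0,1] : ∀ {x} m → x ∈[0,1] → (x ^ℚ m) ∈[0,1]
^ℚ-∈[0,1] zero    x∈ = 0≤ℕ→ℚ 1 , ≤-refl
^ℚ-∈[0,1] (suc m) x∈ = ∈[0,1]-* x∈ (^ℚ-∈[0,1] m x∈)

^ℚ-distribˡ-+-* : ∀ x a b → x ^ℚ (a ℕ.+ b) ≡ x ^ℚ a * x ^ℚ b
^ℚ-distribˡ-+-* x zero    b = sym (*-identityˡ _)
^ℚ-distribˡ-+-* x (suc a) b = trans (cong (x *_) (^ℚ-distribˡ-+-* x a b)) (sym (*-assoc x _ _))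

^ℚ-distribʳ-* : ∀ x y m → (x * y) ^ℚ m ≡ x ^ℚ m * y ^ℚ m
^ℚ-distribʳ-* x y zero    = refl
^ℚ-distribʳ-* x y (suc m) = trans (cong ((x * y) *_) (^ℚ-distribʳ-* x y m))
  (solve 4 (λ x y a b → (x :* y) :* (a :* b) := (x :* a) :* (y :* b)) refl x y (x ^ℚ m) (y ^ℚ m))

x^ℚ[1+m]≤0⇒x≡0 : ∀ {x} m → 0ℚ ≤ℚ x → x ^ℚ suc m ≤ℚ 0ℚ → x ≡ 0ℚ
x^ℚ[1+m]≤0⇒x≡0 {x} m 0≤x x^[1+m]≤0 with 0ℚ <? x
... | yes 0<x = ⊥-elim (<-irrefl refl (<-≤-trans (0<^ℚ (suc m) 0<x) x^[1+m]≤0))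
... | no  0≮x = ≤-antisym (≮⇒≥ 0≮x) 0≤x

sumℚ : List ℚ → ℚ
sumℚ = foldr _+_ 0ℚ

productℚ : List ℚ → ℚ
productℚ = foldr _*_ 1ℚ

0≤sumℚ : ∀ {xs} → All (0ℚ ≤ℚ_) xs → 0ℚ ≤ℚ sumℚ xs
0≤sumℚ []           = ≤-refl
0≤sumℚ (0≤x ∷ 0≤xs) = +-mono-≤ 0≤x (0≤sumℚ 0≤xs)

0≤productℚ : ∀ {xs} → All (0ℚ ≤ℚ_) xs → 0ℚ ≤ℚ productℚ xs
0≤productℚ []           = 0≤ℕ→ℚ 1
0≤productℚ (0≤x ∷ 0≤xs) = 0≤* 0≤x (0≤productℚ 0≤xs)

productℚ-∈[0,1] : ∀ {xs} → All _∈[0,1] xs → productℚ xs ∈[0,1]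
productℚ-∈[0,1] []         = 0≤ℕ→ℚ 1 , ≤-refl
productℚ-∈[0,1] (x∈ ∷ xs∈) = ∈[0,1]-* x∈ (productℚ-∈[0,1] xs∈)

sumℚ-mono : ∀ {A : Set} {f g : A → ℚ} → (∀ x → f x ≤ℚ g x) → ∀ xs → sumℚ (map f xs) ≤ℚ sumℚ (map g xs)
sumℚ-mono f≤g []       = ≤-refl
sumℚ-mono f≤g (x ∷ xs) = +-mono-≤ (f≤g x) (sumℚ-mono f≤g xs)

productℚ-mono : ∀ {A : Set} {f g : A → ℚ} → (∀ x → 0ℚ ≤ℚ f x) → (∀ x → f x ≤ℚ g x) →
                ∀ xs → productℚ (map f xs) ≤ℚ productℚ (map g xs)
productℚ-mono 0≤f f≤g []       = ≤-refl
productℚ-mono 0≤f f≤g (x ∷ xs) = *-mono-≤-0≤ (≤-trans (0≤f x) (f≤g x)) (0≤productℚ (map⁺ (universal 0≤f xs)))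
                                              (f≤g x) (productℚ-mono 0≤f f≤g xs)

*-distribˡ-sumℚ : ∀ {A : Set} r (f : A → ℚ) xs → r * sumℚ (map f xs) ≡ sumℚ (map (λ x → r * f x) xs)
*-distribˡ-sumℚ r f []       = *-zeroʳ r
*-distribˡ-sumℚ r f (x ∷ xs) = trans (*-distribˡ-+ r (f x) _) (cong (r * f x +_) (*-distribˡ-sumℚ r f xs))

sumℚ-ones : ∀ {A : Set} (xs : List A) → sumℚ (map (λ _ → 1ℚ) xs) ≡ ℕ→ℚ (length xs)
sumℚ-ones []       = refl
sumℚ-ones (x ∷ xs) = trans (cong (1ℚ +_) (sumℚ-ones xs)) (sym (ℕ→ℚ-+ 1 (length xs)))

sumℚ-complement : ∀ {A : Set} (f : A → ℚ) cs →
                  sumℚ (map (λ c → 1ℚ - f c) cs) + sumℚ (map f cs) ≡ ℕ→ℚ (length cs)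
sumℚ-complement f []       = refl
sumℚ-complement f (c ∷ cs) = begin-equality
  (1ℚ - f c + S₁) + (f c + S₂)
    ≡⟨ solve 3 (λ y s t → (con 1ℚ :- y :+ s) :+ (y :+ t) := con 1ℚ :+ (s :+ t)) refl (f c) S₁ S₂ ⟩
  1ℚ + (S₁ + S₂)             ≡⟨ cong (1ℚ +_) (sumℚ-complement f cs) ⟩
  1ℚ + ℕ→ℚ (length cs)       ≡⟨ ℕ→ℚ-+ 1 (length cs) ⟨
  ℕ→ℚ (suc (length cs))      ∎
  where
  S₁ = sumℚ (map (λ c → 1ℚ - f c) cs)
  S₂ = sumℚ (map f cs)

productℚ-≡1 : ∀ {A : Set} {f : A → ℚ} {xs} → All (λ x → f x ≡ 1ℚ) xs → productℚ (map f xs) ≡ 1ℚ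
productℚ-≡1 []            = refl
productℚ-≡1 (fx≡1 ∷ fxs≡1) = cong₂ _*_ fx≡1 (productℚ-≡1 fxs≡1)

productℚ-const : ∀ {A : Set} {f : A → ℚ} {r} {xs} → All (λ x → f x ≡ r) xs → productℚ (map f xs) ≡ r ^ℚ length xs
productℚ-const []             = refl
productℚ-const (fx≡r ∷ fxs≡r) = cong₂ _*_ fx≡r (productℚ-const fxs≡r)

^ℚ-sum : ∀ {A : Set} r (d : A → ℕ) xs → r ^ℚ sum (map d xs) ≡ productℚ (map (λ x → r ^ℚ d x) xs)
^ℚ-sum r d []       = refl
^ℚ-sum r d (x ∷ xs) = trans (^ℚ-distribˡ-+-* r (d x) (sum (map d xs))) (cong (r ^ℚ d x *_) (^ℚ-sum r d xs))

ℕ→ℚ[p∸1]^ℚ-sum : ∀ {A : Set} {p} → 1 ≤ p → (d : A → ℕ) (cs : List A) →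
  ℕ→ℚ (p ∸ 1) ^ℚ sum (map d cs) ≡ ℕ→ℚ p ^ℚ sum (map d cs) * productℚ (map (λ c → (1ℚ - 1/ℕ p) ^ℚ d c) cs)
ℕ→ℚ[p∸1]^ℚ-sum {p = p} 1≤p d cs = begin-equality
  ℕ→ℚ (p ∸ 1) ^ℚ D                      ≡⟨ cong (_^ℚ D) (ℕ→ℚ-∸1 1≤p) ⟩
  (ℕ→ℚ p * (1ℚ - 1/ℕ p)) ^ℚ D           ≡⟨ ^ℚ-distribʳ-* (ℕ→ℚ p) (1ℚ - 1/ℕ p) D ⟩
  ℕ→ℚ p ^ℚ D * (1ℚ - 1/ℕ p) ^ℚ D        ≡⟨ cong (ℕ→ℚ p ^ℚ D *_) (^ℚ-sum (1ℚ - 1/ℕ p) d cs) ⟩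
  ℕ→ℚ p ^ℚ D * productℚ (map (λ c → (1ℚ - 1/ℕ p) ^ℚ d c) cs)  ∎
  where D = sum (map d cs)

1≤product : ∀ {A : Set} (q : A → ℕ) → (∀ i → 1 ≤ q i) → ∀ is → 1 ≤ product (map q is)
1≤product q 1≤q []       = s≤s z≤n
1≤product q 1≤q (i ∷ is) = ℕ.*-mono-≤ (1≤q i) (1≤product q 1≤q is)

productℚ-1/ℕ : ∀ {A : Set} (q : A → ℕ) → (∀ i → 1 ≤ q i) → ∀ is →
               productℚ (map (1/ℕ ∘ q) is) ≡ 1/ℕ (product (map q is))
productℚ-1/ℕ q 1≤q []       = refl
productℚ-1/ℕ q 1≤q (i ∷ is) = trans (cong (1/ℕ (q i) *_) (productℚ-1/ℕ q 1≤q is))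
                                    (sym (1/ℕ-* (1≤q i) (1≤product q 1≤q is)))

-- The AM-GM inequality

0≤[x^ℚk-y^ℚk]*[x-y] : ∀ k {x y} → 0ℚ ≤ℚ x → 0ℚ ≤ℚ y → 0ℚ ≤ℚ (x ^ℚ k - y ^ℚ k) * (x - y)
0≤[x^ℚk-y^ℚk]*[x-y] k {x} {y} 0≤x 0≤y with ≤-total x y
... | inj₁ x≤y = subst (0ℚ ≤ℚ_)
        (solve 4 (λ X Y x y → (Y :- X) :* (y :- x) := (X :- Y) :* (x :- y)) refl (x ^ℚ k) (y ^ℚ k) x y)
        (0≤* (p≤q⇒0≤q-p (^ℚ-monoˡ-≤ k 0≤x x≤y)) (p≤q⇒0≤q-p x≤y))
... | inj₂ y≤x = 0≤* (p≤q⇒0≤q-p (^ℚ-monoˡ-≤ k 0≤y y≤x)) (p≤q⇒0≤q-p y≤x)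

-- The difference of the two sides for k + 1 is m times the difference for k
-- plus (u ^ℚ (k + 1) - m ^ℚ (k + 1)) * (u - m).
weighted-amgm : ∀ k {u m} → 0ℚ ≤ℚ u → 0ℚ ≤ℚ m →
                ℕ→ℚ (suc k) * u * m ^ℚ k ≤ℚ u ^ℚ suc k + ℕ→ℚ k * m ^ℚ suc k
weighted-amgm zero {u} {m} _ _ = ≤-by-difference ≤-refl
  (solve 2 (λ u m → u :* con 1ℚ :+ con 0ℚ :* (m :* con 1ℚ) :- con 1ℚ :* u :* con 1ℚ := con 0ℚ) refl u m)
weighted-amgm (suc k) {u} {m} 0≤u 0≤m rewrite ℕ→ℚ-+ 1 (suc k) | ℕ→ℚ-+ 1 k =
  ≤-by-difference (+-mono-≤ (0≤* 0≤m (p≤q⇒0≤q-p IH)) (0≤[x^ℚk-y^ℚk]*[x-y] (suc k) 0≤u 0≤m))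
    (solve 5 (λ N u m A U →
        (u :* U :+ (con 1ℚ :+ N) :* (m :* (m :* A))) :- ((con 1ℚ :+ (con 1ℚ :+ N)) :* u :* (m :* A))
        := m :* ((U :+ N :* (m :* A)) :- (con 1ℚ :+ N) :* u :* A) :+ (U :- m :* A) :* (u :- m))
      refl (ℕ→ℚ k) u m (m ^ℚ k) (u ^ℚ suc k))
  where
  IH : (1ℚ + ℕ→ℚ k) * u * m ^ℚ k ≤ℚ u ^ℚ suc k + ℕ→ℚ k * m ^ℚ suc k
  IH = subst (λ K → K * u * m ^ℚ k ≤ℚ u ^ℚ suc k + ℕ→ℚ k * m ^ℚ suc k) (ℕ→ℚ-+ 1 k) (weighted-amgm k 0≤u 0≤m)

amgm-shift : ∀ m {a x x′} → 0ℚ ≤ℚ x → 0ℚ ≤ℚ x′ → ℕ→ℚ m * x′ ≡ ℕ→ℚ (suc m) * x - a →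
             a * x′ ^ℚ m ≤ℚ x ^ℚ suc m
amgm-shift m {a} {x} {x′} 0≤x 0≤x′ mx′≡ =
  ≤-by-difference (p≤q⇒0≤q-p (weighted-amgm m 0≤x 0≤x′)) (begin-equality
    U - a * X                        ≡⟨ cong (λ b → U - b * X) a≡ ⟩
    U - (M₁ * x - M * x′) * X        ≡⟨ solve 6 (λ U M₁ x M x′ X → U :- (M₁ :* x :- M :* x′) :* X
                                                                   := (U :+ M :* (x′ :* X)) :- M₁ :* x :* X)
                                                 refl U M₁ x M x′ X ⟩
    U + M * (x′ * X) - M₁ * x * X    ∎)
  where
  U = x ^ℚ suc m
  X = x′ ^ℚ m
  M = ℕ→ℚ m
  M₁ = ℕ→ℚ (suc m)
  a≡ : a ≡ M₁ * x - M * x′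
  a≡ = trans (solve 2 (λ a y → a := y :- (y :- a)) refl a (M₁ * x)) (cong (M₁ * x -_) (sym mx′≡))

-- If (m + 1) x > a then x′ = ((m + 1) x - a) / m satisfies a x′ ^ m ≤ x ^ (m + 1) ≤ a ∏ as,
-- so the induction hypothesis applies to x′ and as.
amgm : ∀ (as : List ℚ) {x} → All (0ℚ ≤ℚ_) as → 0ℚ ≤ℚ x →
       x ^ℚ length as ≤ℚ productℚ as → ℕ→ℚ (length as) * x ≤ℚ sumℚ as
amgm []           {x} _ _ _ = ≤-reflexive (*-zeroˡ x)
amgm (a ∷ [])     {x} _ _ x^1≤a*1 = ≤-by-difference (p≤q⇒0≤q-p x^1≤a*1)
  (solve 2 (λ a x → a :+ con 0ℚ :- con 1ℚ :* x := a :* con 1ℚ :- x :* con 1ℚ) refl a x)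
amgm (a ∷ as@(_ ∷ _)) {x} (0≤a ∷ 0≤as) 0≤x x^≤∏ with ℕ→ℚ (suc (length as)) * x ≤? a | 0ℚ <? a
... | yes M₁x≤a | _       =
  ≤-trans M₁x≤a (≤-by-difference (0≤sumℚ 0≤as) (solve 2 (λ a s → a :+ s :- a := s) refl a (sumℚ as)))
... | no  M₁x≰a | yes 0<a = ≤-by-difference (p≤q⇒0≤q-p (amgm as 0≤as 0≤x′ x′^≤∏))
  (trans (solve 3 (λ a s y → a :+ s :- y := s :- (y :- a)) refl a (sumℚ as) (M₁ * x))
         (cong (sumℚ as -_) (sym mx′≡)))
  where
  m = length as
  M₁ = ℕ→ℚ (suc m)
  x′ = (M₁ * x - a) * 1/ℕ m
  0≤x′ : 0ℚ ≤ℚ x′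
  0≤x′ = 0≤* (p≤q⇒0≤q-p (<⇒≤ (≰⇒> M₁x≰a))) (0≤1/ℕ m)
  mx′≡ : ℕ→ℚ m * x′ ≡ M₁ * x - a
  mx′≡ = trans (solve 3 (λ m d i → m :* (d :* i) := d :* (m :* i)) refl (ℕ→ℚ m) (M₁ * x - a) (1/ℕ m))
               (trans (cong ((M₁ * x - a) *_) (ℕ→ℚ*1/ℕ {m} (s≤s z≤n))) (*-identityʳ _))
  x′^≤∏ : x′ ^ℚ m ≤ℚ productℚ as
  x′^≤∏ = *-cancelˡ-≤-0< 0<a (≤-trans (amgm-shift m 0≤x 0≤x′ mx′≡) x^≤∏)
... | no  _     | no  0≮a = begin
  M₁ * x                 ≡⟨ cong (M₁ *_) x≡0 ⟩
  M₁ * 0ℚ                ≡⟨ *-zeroʳ M₁ ⟩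
  0ℚ                     ≤⟨ +-mono-≤ 0≤a (0≤sumℚ 0≤as) ⟩
  a + sumℚ as            ∎
  where
  M₁ = ℕ→ℚ (suc (length as))
  a≡0 : a ≡ 0ℚ
  a≡0 = ≤-antisym (≮⇒≥ 0≮a) 0≤a
  x≡0 : x ≡ 0ℚ
  x≡0 = x^ℚ[1+m]≤0⇒x≡0 (length as) 0≤x
          (≤-trans x^≤∏ (≤-reflexive (trans (cong (_* productℚ as) a≡0) (*-zeroˡ (productℚ as)))))

amgm-complementary : ∀ {A : Set} (f : A → ℚ) (cs : List A) {x y} → (∀ c → f c ∈[0,1]) → 1 ≤ length cs →
                     0ℚ ≤ℚ x → 0ℚ ≤ℚ y →
                     x ^ℚ length cs ≤ℚ productℚ (map (λ c → 1ℚ - f c) cs) →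
                     y ^ℚ length cs ≤ℚ productℚ (map f cs) →
                     x + y ≤ℚ 1ℚ
amgm-complementary f cs {x} {y} f∈ 1≤|cs| 0≤x 0≤y x^≤∏ y^≤∏ = *-cancelˡ-≤-0< (0<ℕ→ℚ 1≤|cs|) (begin
  M * (x + y)
    ≡⟨ *-distribˡ-+ M x y ⟩
  M * x + M * y
    ≤⟨ +-mono-≤ (amgm-map (λ c → 1ℚ - f c) (λ c → proj₁ (1-∈[0,1] (f∈ c))) 0≤x x^≤∏)
                (amgm-map f (λ c → proj₁ (f∈ c)) 0≤y y^≤∏) ⟩
  sumℚ (map (λ c → 1ℚ - f c) cs) + sumℚ (map f cs)
    ≡⟨ sumℚ-complement f cs ⟩
  M
    ≡⟨ *-identityʳ M ⟨
  M * 1ℚ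
    ∎)
  where
  M = ℕ→ℚ (length cs)
  amgm-map : ∀ (g : _ → ℚ) {z} → (∀ c → 0ℚ ≤ℚ g c) → 0ℚ ≤ℚ z →
             z ^ℚ length cs ≤ℚ productℚ (map g cs) → M * z ≤ℚ sumℚ (map g cs)
  amgm-map g {z} 0≤g 0≤z z^≤∏ rewrite sym (length-map g cs) =
    amgm (map g cs) (map⁺ (universal 0≤g cs)) 0≤z z^≤∏

any-filter⁺ : ∀ {A : Set} {P Q : A → Set} (Q? : Decidable Q) {xs} → Any (λ x → P x × Q x) xs → Any P (filter Q? xs)
any-filter⁺ Q? p with AnyP.filter⁺ Q? p
... | inj₁ p′ = Any.map proj₁ p′
... | inj₂ ¬q = ⊥-elim (¬q (proj₂ (lookup-result p)))

length-filter-¬?≡0⇒All : ∀ {A : Set} {Q : A → Set} (Q? : Decidable Q) xs →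
                          length (filter (λ x → ¬? (Q? x)) xs) ≡ 0 → All Q xs
length-filter-¬?≡0⇒All Q? []       _  = []
length-filter-¬?≡0⇒All Q? (x ∷ xs) ≡0 with Q? x
... | yes Qx = Qx ∷ length-filter-¬?≡0⇒All Q? xs ≡0
... | no  _  = ⊥-elim (ℕ.1+n≢0 ≡0)

length-filter-map : ∀ {A B : Set} {P : B → Set} (P? : Decidable P) (f : A → B) xs →
                    length (filter P? (map f xs)) ≡ length (filter (P? ∘ f) xs)
length-filter-map P? f []       = refl
length-filter-map P? f (x ∷ xs) with does (P? (f x))
... | true  = cong suc (length-filter-map P? f xs)
... | false = length-filter-map P? f xs

length-filter-concatMap : ∀ {A B : Set} {P : B → Set} (P? : Decidable P) (h : A → List B) xs →
  ℕ→ℚ (length (filter P? (concatMap h xs))) ≡ sumℚ (map (λ x → ℕ→ℚ (length (filter P? (h x)))) xs)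
length-filter-concatMap P? h []       = refl
length-filter-concatMap P? h (x ∷ xs) = begin-equality
  ℕ→ℚ (length (filter P? (h x ++ concatMap h xs)))
    ≡⟨ cong (ℕ→ℚ ∘ length) (filter-++ P? (h x) (concatMap h xs)) ⟩
  ℕ→ℚ (length (filter P? (h x) ++ filter P? (concatMap h xs)))
    ≡⟨ cong ℕ→ℚ (length-++ (filter P? (h x))) ⟩
  ℕ→ℚ (length (filter P? (h x)) ℕ.+ length (filter P? (concatMap h xs)))
    ≡⟨ ℕ→ℚ-+ (length (filter P? (h x))) (length (filter P? (concatMap h xs))) ⟩
  ℕ→ℚ (length (filter P? (h x))) + ℕ→ℚ (length (filter P? (concatMap h xs)))
    ≡⟨ cong (ℕ→ℚ (length (filter P? (h x))) +_) (length-filter-concatMap P? h xs) ⟩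
  sumℚ (map (λ x → ℕ→ℚ (length (filter P? (h x)))) (x ∷ xs))
    ∎

length-concatMap-map : ∀ {A B C : Set} (k : A → B → C) xs ys →
                       length (concatMap (λ a → map (k a) ys) xs) ≡ length xs ℕ.* length ys
length-concatMap-map k []       ys = refl
length-concatMap-map k (x ∷ xs) ys = trans (length-++ (map (k x) ys))
                                           (cong₂ ℕ._+_ (length-map (k x) ys) (length-concatMap-map k xs ys))

map-lookup-allFin : ∀ {A : Set} (xs : List A) → map (lookup xs) (allFin (length xs)) ≡ xs
map-lookup-allFin xs = trans (map-tabulate id (lookup xs)) (tabulate-lookup xs)

-- Weights of vertex sets

containsZero : ∀ {n} → List (Fin (suc n)) → Bool
containsZero []          = false
containsZero (zero  ∷ S) = true
containsZero (suc _ ∷ S) = containsZero S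

removeZero : ∀ {n} → List (Fin (suc n)) → List (Fin n)
removeZero []          = []
removeZero (zero  ∷ S) = removeZero S
removeZero (suc u ∷ S) = u ∷ removeZero S

dropZero : ∀ {n} → List (List (Fin (suc n))) → List (List (Fin (suc n)))
dropZero = filterᵇ (not ∘ containsZero)

-- weight L S is the product of 1/ℕ (length (L u)) over the vertices u of S,
-- each counted once however often it is listed: an upper bound for the
-- probability that S is monochromatic in a given colour.
weight : ∀ {n} → ListAssignment n → List (Fin n) → ℚ
weight {zero}  L S = 1ℚ
weight {suc n} L S = if containsZero S then 1/ℕ (length (L zero)) * weight (L ∘ suc) (removeZero S)
                                      else weight (L ∘ suc) (removeZero S)

survivalBound : ∀ {n} → ListAssignment n → List (List (Fin n)) → ℚ
survivalBound L Fs = productℚ (map (λ S → 1ℚ - weight L S) Fs)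

blockingBound : ∀ {n} → ListAssignment n → List ℕ → (ℕ → List (List (Fin n))) → ℚ
blockingBound L C F = productℚ (map (λ c → 1ℚ - survivalBound L (F c)) C)

weight-∈[0,1] : ∀ {n} (L : ListAssignment n) S → weight L S ∈[0,1]
weight-∈[0,1] {zero}  L S = 0≤ℕ→ℚ 1 , ≤-refl
weight-∈[0,1] {suc n} L S with containsZero S
... | true  = ∈[0,1]-* (0≤1/ℕ (length (L zero)) , 1/ℕ≤1 (length (L zero))) (weight-∈[0,1] (L ∘ suc) (removeZero S))
... | false = weight-∈[0,1] (L ∘ suc) (removeZero S)

survivalBound-∈[0,1] : ∀ {n} (L : ListAssignment n) Fs → survivalBound L Fs ∈[0,1]
survivalBound-∈[0,1] L Fs = productℚ-∈[0,1] (map⁺ (universal (λ S → 1-∈[0,1] (weight-∈[0,1] L S)) Fs))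

blockingBound-∈[0,1] : ∀ {n} (L : ListAssignment n) C F → blockingBound L C F ∈[0,1]
blockingBound-∈[0,1] L C F = productℚ-∈[0,1] (map⁺ (universal (λ c → 1-∈[0,1] (survivalBound-∈[0,1] L (F c))) C))

containsZero-false : ∀ {n} {S : List (Fin (suc n))} → All (zero ≢_) S → containsZero S ≡ false
containsZero-false {S = []}        []           = refl
containsZero-false {S = zero  ∷ S} (0≢0 ∷ _)    = ⊥-elim (0≢0 refl)
containsZero-false {S = suc _ ∷ S} (_ ∷ 0∉S)    = containsZero-false 0∉S

removeZero-All≢ : ∀ {n} {u : Fin n} {S : List (Fin (suc n))} → All (suc u ≢_) S → All (u ≢_) (removeZero S)
removeZero-All≢ {S = []}        []           = []
removeZero-All≢ {S = zero  ∷ S} (_ ∷ u∉S)    = removeZero-All≢ u∉S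
removeZero-All≢ {S = suc _ ∷ S} (u≢w ∷ u∉S)  = (u≢w ∘ cong suc) ∷ removeZero-All≢ u∉S

removeZero-unique : ∀ {n} {S : List (Fin (suc n))} → Unique S → Unique (removeZero S)
removeZero-unique {S = []}        []           = []
removeZero-unique {S = zero  ∷ S} (_ ∷ !S)     = removeZero-unique !S
removeZero-unique {S = suc _ ∷ S} (u∉S ∷ !S)   = removeZero-All≢ u∉S ∷ removeZero-unique !S

productℚ-removeZero : ∀ {n} (w : Fin (suc n) → ℚ) {S} → Unique S →
  productℚ (map w S) ≡ (if containsZero S then w zero * productℚ (map (w ∘ suc) (removeZero S))
                                          else productℚ (map (w ∘ suc) (removeZero S)))
productℚ-removeZero w {[]}        []         = refl
productℚ-removeZero w {zero  ∷ S} (0∉S ∷ !S) =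
  cong (w zero *_) (trans (productℚ-removeZero w !S) (cong (if_then w zero * R else R) (containsZero-false 0∉S)))
  where R = productℚ (map (w ∘ suc) (removeZero S))
productℚ-removeZero w {suc u ∷ S} (_ ∷ !S) with containsZero S | productℚ-removeZero w !S
... | true  | ∏≡ = trans (cong (w (suc u) *_) ∏≡)
                     (solve 3 (λ a b c → a :* (b :* c) := b :* (a :* c)) refl (w (suc u)) (w zero) (productℚ (map (w ∘ suc) (removeZero S))))
... | false | ∏≡ = cong (w (suc u) *_) ∏≡

weight≡productℚ : ∀ {n} (L : ListAssignment n) {S} → Unique S → weight L S ≡ productℚ (map (1/ℕ ∘ length ∘ L) S)
weight≡productℚ {zero}  L {[]} [] = refl
weight≡productℚ {suc n} L {S} !S =
  trans (cong (λ r → if containsZero S then 1/ℕ (length (L zero)) * r else r)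
              (weight≡productℚ (L ∘ suc) (removeZero-unique !S)))
        (sym (productℚ-removeZero (1/ℕ ∘ length ∘ L) !S))

module _ {n} (L : ListAssignment (suc n)) where

  private
    t = 1/ℕ (length (L zero))
    t∈ : t ∈[0,1]
    t∈ = 0≤1/ℕ (length (L zero)) , 1/ℕ≤1 (length (L zero))
    s∈ : ∀ S → weight (L ∘ suc) (removeZero S) ∈[0,1]
    s∈ S = weight-∈[0,1] (L ∘ suc) (removeZero S)
    Y Z : List (List (Fin (suc n))) → ℚ
    Y Fs = survivalBound (L ∘ suc) (map removeZero Fs)
    Z Fs = survivalBound (L ∘ suc) (map removeZero (dropZero Fs))

  survivalBound-removeZero-≤ : ∀ Fs → survivalBound (L ∘ suc) (map removeZero Fs)
                                       ≤ℚ survivalBound (L ∘ suc) (map removeZero (dropZero Fs))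
  survivalBound-removeZero-≤ []       = ≤-refl
  survivalBound-removeZero-≤ (S ∷ Fs) with containsZero S
  ... | true  = ≤-trans (≤-by-difference (0≤* (proj₁ (s∈ S)) (proj₁ (survivalBound-∈[0,1] (L ∘ suc) (map removeZero Fs))))
                                          (solve 2 (λ s y → y :- (con 1ℚ :- s) :* y := s :* y) refl s (Y Fs)))
                        (survivalBound-removeZero-≤ Fs)
    where s = weight (L ∘ suc) (removeZero S)
  ... | false = *-monoˡ-≤-0≤ (proj₁ (1-∈[0,1] (s∈ S))) (survivalBound-removeZero-≤ Fs)

  survivalBound-conditioned : ∀ Fs → survivalBound L Fs ≤ℚ
    1/ℕ (length (L zero)) * survivalBound (L ∘ suc) (map removeZero Fs)
      + (1ℚ - 1/ℕ (length (L zero))) * survivalBound (L ∘ suc) (map removeZero (dropZero Fs))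
  survivalBound-conditioned [] =
    ≤-reflexive (solve 1 (λ t → con 1ℚ := t :* con 1ℚ :+ (con 1ℚ :- t) :* con 1ℚ) refl t)
  survivalBound-conditioned (S ∷ Fs) with containsZero S
  ... | true  = begin
    (1ℚ - t * s) * survivalBound L Fs
      ≤⟨ *-monoˡ-≤-0≤ (proj₁ (1-∈[0,1] (∈[0,1]-* t∈ (s∈ S)))) (survivalBound-conditioned Fs) ⟩
    (1ℚ - t * s) * (t * Y Fs + (1ℚ - t) * Z Fs)
      ≤⟨ ≤-by-difference (0≤* (0≤* (0≤* (proj₁ t∈) (proj₁ (s∈ S))) (proj₁ (1-∈[0,1] t∈)))
                              (p≤q⇒0≤q-p (survivalBound-removeZero-≤ Fs)))
           (solve 4 (λ t s y z → (t :* ((con 1ℚ :- s) :* y) :+ (con 1ℚ :- t) :* z)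
                                   :- (con 1ℚ :- t :* s) :* (t :* y :+ (con 1ℚ :- t) :* z)
                                 := t :* s :* (con 1ℚ :- t) :* (z :- y))
                    refl t s (Y Fs) (Z Fs)) ⟩
    t * ((1ℚ - s) * Y Fs) + (1ℚ - t) * Z Fs
      ∎
    where s = weight (L ∘ suc) (removeZero S)
  ... | false = begin
    (1ℚ - s) * survivalBound L Fs
      ≤⟨ *-monoˡ-≤-0≤ (proj₁ (1-∈[0,1] (s∈ S))) (survivalBound-conditioned Fs) ⟩
    (1ℚ - s) * (t * Y Fs + (1ℚ - t) * Z Fs)
      ≡⟨ solve 4 (λ t s y z → (con 1ℚ :- s) :* (t :* y :+ (con 1ℚ :- t) :* z)
                              := t :* ((con 1ℚ :- s) :* y) :+ (con 1ℚ :- t) :* ((con 1ℚ :- s) :* z))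
                 refl t s (Y Fs) (Z Fs) ⟩
    t * ((1ℚ - s) * Y Fs) + (1ℚ - t) * ((1ℚ - s) * Z Fs)
      ∎
    where s = weight (L ∘ suc) (removeZero S)

chosenAt : (α β : ℕ → ℚ) → ℕ → ℕ → ℚ
chosenAt α β x c = if does (x ℕ.≟ c) then β c else α c

chosenProduct : (α β : ℕ → ℚ) → List ℕ → ℕ → ℚ
chosenProduct α β cs x = productℚ (map (chosenAt α β x) cs)

module _ (α β : ℕ → ℚ) (0≤α : ∀ c → 0ℚ ≤ℚ α c) (α≤β : ∀ c → α c ≤ℚ β c) where

  private
    G : List ℕ → ℕ → ℚ
    G = chosenProduct α β

    chosenAt-≢ : ∀ {x c} → x ≢ c → chosenAt α β x c ≡ α c
    chosenAt-≢ {x} {c} x≢c = cong (if_then β c else α c) (dec-false (x ℕ.≟ c) x≢c)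

    chosenAt-≡ : ∀ c → chosenAt α β c c ≡ β c
    chosenAt-≡ c = cong (if_then β c else α c) (dec-true (c ℕ.≟ c) refl)

    G-≢ : ∀ {x cs} → All (x ≢_) cs → G cs x ≡ productℚ (map α cs)
    G-≢ x∉cs = cong productℚ (map-cong-local (All.map chosenAt-≢ x∉cs))

    0≤β-α : ∀ c → 0ℚ ≤ℚ β c - α c
    0≤β-α c = p≤q⇒0≤q-p (α≤β c)

  sumℚ-chosenProduct-∷-≤ : ∀ {c cs} → All (c ≢_) cs → ∀ xs → Unique xs →
    sumℚ (map (chosenProduct α β (c ∷ cs)) xs)
      ≤ℚ α c * sumℚ (map (chosenProduct α β cs) xs) + (β c - α c) * productℚ (map α cs)
  sumℚ-chosenProduct-∷-≤ {c} {cs} c∉cs [] [] =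
    ≤-by-difference (0≤* (0≤β-α c) (0≤productℚ (map⁺ (universal 0≤α cs))))
      (solve 3 (λ a d p → a :* con 0ℚ :+ d :* p :- con 0ℚ := d :* p) refl (α c) (β c - α c) (productℚ (map α cs)))
  sumℚ-chosenProduct-∷-≤ {c} {cs} c∉cs (x ∷ xs) (x∉xs ∷ !xs) with x ℕ.≟ c
  ... | yes refl = ≤-reflexive (begin-equality
    chosenAt α β c c * G cs c + sumℚ (map (G (c ∷ cs)) xs)
      ≡⟨ cong₂ _+_ (cong₂ _*_ (chosenAt-≡ c) (G-≢ c∉cs)) rest≡ ⟩
    β c * A + α c * Σ
      ≡⟨ solve 4 (λ b a p s → b :* p :+ a :* s := a :* (p :+ s) :+ (b :- a) :* p) refl (β c) (α c) A Σ ⟩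
    α c * (A + Σ) + (β c - α c) * A
      ≡⟨ cong (λ g → α c * (g + Σ) + (β c - α c) * A) (G-≢ c∉cs) ⟨
    α c * (G cs c + Σ) + (β c - α c) * A
      ∎)
    where
    A = productℚ (map α cs)
    Σ = sumℚ (map (G cs) xs)
    rest≡ : sumℚ (map (G (c ∷ cs)) xs) ≡ α c * Σ
    rest≡ = trans (cong sumℚ (map-cong-local (All.map (λ {y} c≢y → cong (_* G cs y) (chosenAt-≢ (≢-sym c≢y))) x∉xs)))
                  (sym (*-distribˡ-sumℚ (α c) (G cs) xs))
  ... | no  x≢c  = begin
    chosenAt α β x c * G cs x + sumℚ (map (G (c ∷ cs)) xs)
      ≡⟨ cong (λ g → g * G cs x + sumℚ (map (G (c ∷ cs)) xs)) (chosenAt-≢ x≢c) ⟩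
    α c * G cs x + sumℚ (map (G (c ∷ cs)) xs)
      ≤⟨ +-monoʳ-≤ (α c * G cs x) (sumℚ-chosenProduct-∷-≤ c∉cs xs !xs) ⟩
    α c * G cs x + (α c * sumℚ (map (G cs) xs) + R)
      ≡⟨ solve 4 (λ a g s r → a :* g :+ (a :* s :+ r) := a :* (g :+ s) :+ r) refl (α c) (G cs x) (sumℚ (map (G cs) xs)) R ⟩
    α c * (G cs x + sumℚ (map (G cs) xs)) + R
      ∎
    where
    R = (β c - α c) * productℚ (map α cs)

  -- A vertex takes a single colour x, which raises only the factor of x from α to β.
  sumℚ-chosenProduct-≤ : ∀ xs cs → Unique xs → Unique cs → 1 ≤ length xs →
    sumℚ (map (chosenProduct α β cs) xs)
      ≤ℚ ℕ→ℚ (length xs) * productℚ (map (λ c → 1/ℕ (length xs) * β c + (1ℚ - 1/ℕ (length xs)) * α c) cs)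
  sumℚ-chosenProduct-≤ xs []       !xs []           _      = ≤-reflexive (trans (sumℚ-ones xs) (sym (*-identityʳ _)))
  sumℚ-chosenProduct-≤ xs (c ∷ cs) !xs (c∉cs ∷ !cs) 1≤|xs| = begin
    sumℚ (map (G (c ∷ cs)) xs)
      ≤⟨ sumℚ-chosenProduct-∷-≤ c∉cs xs !xs ⟩
    α c * sumℚ (map (G cs) xs) + (β c - α c) * productℚ (map α cs)
      ≤⟨ +-mono-≤ (*-monoˡ-≤-0≤ (0≤α c) (sumℚ-chosenProduct-≤ xs cs !xs !cs 1≤|xs|))
                  (*-monoˡ-≤-0≤ (0≤β-α c) (productℚ-mono 0≤α α≤mix cs)) ⟩
    α c * (N * P) + (β c - α c) * P
      ≡⟨ cong (λ r → α c * (N * P) + (β c - α c) * r) (trans (cong (_* P) (ℕ→ℚ*1/ℕ 1≤|xs|)) (*-identityˡ P)) ⟨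
    α c * (N * P) + (β c - α c) * ((N * t) * P)
      ≡⟨ solve 5 (λ a b N t P → a :* (N :* P) :+ (b :- a) :* ((N :* t) :* P)
                                := N :* ((t :* b :+ (con 1ℚ :- t) :* a) :* P))
                 refl (α c) (β c) N t P ⟩
    N * (mix c * P)
      ∎
    where
    N = ℕ→ℚ (length xs)
    t = 1/ℕ (length xs)
    mix : ℕ → ℚ
    mix c = t * β c + (1ℚ - t) * α c
    P = productℚ (map mix cs)
    α≤mix : ∀ c → α c ≤ℚ mix c
    α≤mix c = ≤-by-difference (0≤* (0≤1/ℕ (length xs)) (0≤β-α c))
      (solve 3 (λ t b a → t :* b :+ (con 1ℚ :- t) :* a :- a := t :* (b :- a)) refl t (β c) (α c))

-- Random list colourings

ListColouring : ∀ {n} → ListAssignment n → Set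
ListColouring {n} L = (u : Fin n) → Fin (length (L u))

colourings : ∀ {n} (L : ListAssignment n) → List (ListColouring L)
colourings {n} L = allChoices n (λ u → length (L u))

colourOf : ∀ {n} (L : ListAssignment n) → ListColouring L → Fin n → ℕ
colourOf L φ u = lookup (L u) (φ u)

Monochromatic : ∀ {n} (L : ListAssignment n) → ListColouring L → ℕ → List (Fin n) → Set
Monochromatic L φ c S = All (λ u → colourOf L φ u ≡ c) S

Blocked : ∀ {n} (L : ListAssignment n) → (ℕ → List (List (Fin n))) → ListColouring L → ℕ → Set
Blocked L F φ c = Any (Monochromatic L φ c) (F c)

extend : ∀ {n} (L : ListAssignment (suc n)) → Fin (length (L zero)) → ListColouring (L ∘ suc) → ListColouring L
extend L a g = consF {f = λ u → length (L u)} a g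

-- The sets that can still block colour c once vertex 0 has received colour x.
condition : ∀ {n} → (ℕ → List (List (Fin (suc n)))) → ℕ → ℕ → List (List (Fin n))
condition F x c = if does (x ℕ.≟ c) then map removeZero (F c) else map removeZero (dropZero (F c))

condition-refl : ∀ {n} (F : ℕ → List (List (Fin (suc n)))) c → condition F c c ≡ map removeZero (F c)
condition-refl F c = cong (if_then map removeZero (F c) else map removeZero (dropZero (F c))) (dec-true (c ℕ.≟ c) refl)

condition-≢ : ∀ {n} (F : ℕ → List (List (Fin (suc n)))) {x c} → x ≢ c →
              condition F x c ≡ map removeZero (dropZero (F c))
condition-≢ F {x} {c} x≢c =
  cong (if_then map removeZero (F c) else map removeZero (dropZero (F c))) (dec-false (x ℕ.≟ c) x≢c)

module _ {n} {L : ListAssignment (suc n)} (a : Fin (length (L zero))) (g : ListColouring (L ∘ suc)) where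

  Monochromatic-removeZero : ∀ {c} S → Monochromatic L (extend L a g) c S → Monochromatic (L ∘ suc) g c (removeZero S)
  Monochromatic-removeZero []          []         = []
  Monochromatic-removeZero (zero  ∷ S) (_ ∷ mono) = Monochromatic-removeZero S mono
  Monochromatic-removeZero (suc u ∷ S) (e ∷ mono) = e ∷ Monochromatic-removeZero S mono

  Monochromatic-containsZero : ∀ {c} S → Monochromatic L (extend L a g) c S → containsZero S ≡ true → lookup (L zero) a ≡ c
  Monochromatic-containsZero (zero  ∷ S) (e ∷ _)    _ = e
  Monochromatic-containsZero (suc u ∷ S) (_ ∷ mono) 0∈S = Monochromatic-containsZero S mono 0∈S

  blocked-extend : ∀ {F c} → Blocked L F (extend L a g) c → Blocked (L ∘ suc) (condition F (lookup (L zero) a)) g c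
  blocked-extend {F} {c} blocked with lookup (L zero) a ℕ.≟ c
  ... | yes refl = subst (Any _) (sym (condition-refl F c))
                     (AnyP.map⁺ (Any.map (λ {S} → Monochromatic-removeZero S) blocked))
  ... | no  a≢c  = subst (Any _) (sym (condition-≢ F a≢c))
                     (AnyP.map⁺ (Any.map (λ {S} → Monochromatic-removeZero S)
                       (any-filter⁺ (T? ∘ not ∘ containsZero) (Any.map (λ {S} mono → mono , avoidsZero S mono) blocked))))
    where
    avoidsZero : ∀ S → Monochromatic L (extend L a g) c S → T (not (containsZero S))
    avoidsZero S mono with containsZero S in 0∈S
    ... | true  = ⊥-elim (a≢c (Monochromatic-containsZero S mono 0∈S))
    ... | false = tt

module _ {n} (L : ListAssignment (suc n)) where

  count-colourings-suc : ∀ {P : ListColouring L → Set} (P? : Decidable P) →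
    ℕ→ℚ (length (filter P? (colourings L)))
      ≡ sumℚ (map (λ a → ℕ→ℚ (length (filter (P? ∘ extend L a) (colourings (L ∘ suc))))) (allFin (length (L zero))))
  count-colourings-suc P? =
    trans (length-filter-concatMap P? (λ a → map (extend L a) (colourings (L ∘ suc))) (allFin (length (L zero))))
          (cong sumℚ (map-cong (λ a → cong ℕ→ℚ (length-filter-map P? (extend L a) (colourings (L ∘ suc))))
                               (allFin (length (L zero)))))

  length-colourings-suc : length (colourings L) ≡ length (L zero) ℕ.* length (colourings (L ∘ suc))
  length-colourings-suc = trans (length-concatMap-map (extend L) (allFin (length (L zero))) (colourings (L ∘ suc)))
                                (cong (ℕ._* length (colourings (L ∘ suc))) (length-tabulate {n = length (L zero)} id))

1≤length-colourings : ∀ {n} (L : ListAssignment n) → (∀ u → 1 ≤ length (L u)) → 1 ≤ length (colourings L)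
1≤length-colourings {zero}  L _     = s≤s z≤n
1≤length-colourings {suc n} L 1≤|L| = subst (1 ≤_) (sym (length-colourings-suc L))
  (ℕ.*-mono-≤ (1≤|L| zero) (1≤length-colourings (L ∘ suc) (1≤|L| ∘ suc)))

blockingBound-conditioned : ∀ {n} (L : ListAssignment (suc n)) → Unique (L zero) → 1 ≤ length (L zero) →
  ∀ {C} → Unique C → ∀ F →
  sumℚ (map (λ x → blockingBound (L ∘ suc) C (condition F x)) (L zero)) ≤ℚ ℕ→ℚ (length (L zero)) * blockingBound L C F
blockingBound-conditioned L !L₀ 1≤|L₀| {C} !C F = begin
  sumℚ (map (λ x → blockingBound (L ∘ suc) C (condition F x)) (L zero))
    ≡⟨ cong sumℚ (map-cong chosen≡ (L zero)) ⟩
  sumℚ (map (chosenProduct α β C) (L zero))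
    ≤⟨ sumℚ-chosenProduct-≤ α β 0≤α α≤β (L zero) C !L₀ !C 1≤|L₀| ⟩
  ℕ→ℚ q * productℚ (map mix C)
    ≤⟨ *-monoˡ-≤-0≤ (0≤ℕ→ℚ q) (productℚ-mono 0≤mix mix≤ C) ⟩
  ℕ→ℚ q * blockingBound L C F
    ∎
  where
  q = length (L zero)
  t = 1/ℕ q
  X Y Z α β mix : ℕ → ℚ
  X c = survivalBound L (F c)
  Y c = survivalBound (L ∘ suc) (map removeZero (F c))
  Z c = survivalBound (L ∘ suc) (map removeZero (dropZero (F c)))
  α c = 1ℚ - Z c
  β c = 1ℚ - Y c
  mix c = t * β c + (1ℚ - t) * α c
  0≤α : ∀ c → 0ℚ ≤ℚ α c
  0≤α c = proj₁ (1-∈[0,1] (survivalBound-∈[0,1] (L ∘ suc) (map removeZero (dropZero (F c)))))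
  α≤β : ∀ c → α c ≤ℚ β c
  α≤β c = ≤-by-difference (p≤q⇒0≤q-p (survivalBound-removeZero-≤ L (F c)))
    (solve 2 (λ y z → (con 1ℚ :- y) :- (con 1ℚ :- z) := z :- y) refl (Y c) (Z c))
  0≤mix : ∀ c → 0ℚ ≤ℚ mix c
  0≤mix c = +-mono-≤ (0≤* (0≤1/ℕ q) (≤-trans (0≤α c) (α≤β c)))
                     (0≤* (proj₁ (1-∈[0,1] (0≤1/ℕ q , 1/ℕ≤1 q))) (0≤α c))
  mix≤ : ∀ c → mix c ≤ℚ 1ℚ - X c
  mix≤ c = ≤-by-difference (p≤q⇒0≤q-p (survivalBound-conditioned L (F c)))
    (solve 4 (λ t x y z → (con 1ℚ :- x) :- (t :* (con 1ℚ :- y) :+ (con 1ℚ :- t) :* (con 1ℚ :- z))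
                          := (t :* y :+ (con 1ℚ :- t) :* z) :- x)
             refl t (X c) (Y c) (Z c))
  chosen≡ : ∀ x → blockingBound (L ∘ suc) C (condition F x) ≡ chosenProduct α β C x
  chosen≡ x = cong productℚ (map-cong (λ c → if-float (λ Fs → 1ℚ - survivalBound (L ∘ suc) Fs) (does (x ℕ.≟ c))) C)

survivalBound-nonempty-Fin0 : ∀ (L : ListAssignment 0) {P : List (Fin 0) → Set} {Fs} → Any P Fs → survivalBound L Fs ≡ 0ℚ
survivalBound-nonempty-Fin0 L {Fs = S ∷ Fs} _ = *-zeroˡ (survivalBound L Fs)

count-allBlocked-≤ : ∀ {n} (L : ListAssignment n) → (∀ u → Unique (L u)) → (∀ u → 1 ≤ length (L u)) →
  ∀ {C} → Unique C → ∀ F {P : ListColouring L → Set} (P? : Decidable P) → (∀ φ → P φ → All (Blocked L F φ) C) →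
  ℕ→ℚ (length (filter P? (colourings L))) ≤ℚ ℕ→ℚ (length (colourings L)) * blockingBound L C F
count-allBlocked-≤ {zero} L _ _ {C} _ F {P} P? allBlocked = single _
  where
  -- colourings L is a singleton; generalising its element avoids comparing absurd lambdas.
  single : ∀ φ → ℕ→ℚ (length (filter P? (φ ∷ []))) ≤ℚ ℕ→ℚ 1 * blockingBound L C F
  single φ with P? φ
  ... | yes p = ≤-reflexive (sym (trans (*-identityˡ _)
                  (productℚ-≡1 (All.map (λ blocked → cong (1ℚ -_) (survivalBound-nonempty-Fin0 L blocked)) (allBlocked φ p)))))
  ... | no  _ = ≤-trans (proj₁ (blockingBound-∈[0,1] L C F)) (≤-reflexive (sym (*-identityˡ _)))
count-allBlocked-≤ {suc n} L !L 1≤|L| {C} !C F P? allBlocked = begin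
  ℕ→ℚ (length (filter P? (colourings L)))
    ≡⟨ count-colourings-suc L P? ⟩
  sumℚ (map (λ a → ℕ→ℚ (length (filter (P? ∘ extend L a) (colourings (L ∘ suc))))) (allFin q))
    ≤⟨ sumℚ-mono IH (allFin q) ⟩
  sumℚ (map (λ a → N * B (lookup (L zero) a)) (allFin q))
    ≡⟨ *-distribˡ-sumℚ N (B ∘ lookup (L zero)) (allFin q) ⟨
  N * sumℚ (map (B ∘ lookup (L zero)) (allFin q))
    ≡⟨ cong (λ xs → N * sumℚ xs) (trans (map-∘ (allFin q)) (cong (map B) (map-lookup-allFin (L zero)))) ⟩
  N * sumℚ (map B (L zero))
    ≤⟨ *-monoˡ-≤-0≤ (0≤ℕ→ℚ (length (colourings (L ∘ suc))))
                    (blockingBound-conditioned L (!L zero) (1≤|L| zero) !C F) ⟩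
  N * (ℕ→ℚ q * blockingBound L C F)
    ≡⟨ solve 3 (λ N Q b → N :* (Q :* b) := (Q :* N) :* b) refl N (ℕ→ℚ q) (blockingBound L C F) ⟩
  ℕ→ℚ q * N * blockingBound L C F
    ≡⟨ cong (_* blockingBound L C F) (trans (cong ℕ→ℚ (length-colourings-suc L)) (ℕ→ℚ-* q _)) ⟨
  ℕ→ℚ (length (colourings L)) * blockingBound L C F
    ∎
  where
  q = length (L zero)
  N = ℕ→ℚ (length (colourings (L ∘ suc)))
  B : ℕ → ℚ
  B x = blockingBound (L ∘ suc) C (condition F x)
  IH : ∀ a → ℕ→ℚ (length (filter (P? ∘ extend L a) (colourings (L ∘ suc)))) ≤ℚ N * B (lookup (L zero) a)
  IH a = count-allBlocked-≤ (L ∘ suc) (!L ∘ suc) (1≤|L| ∘ suc) !C (condition F (lookup (L zero) a)) (P? ∘ extend L a)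
           (λ g p → All.map (blocked-extend {L = L} a g {F}) (allBlocked (extend L a g) p))

-- Edges of a k-partite hypergraph

others : ∀ {k} → Fin k → List (Fin k)
others {k} j = filter (λ i → ¬? (i ≟ᶠ j)) (allFin k)

otherVertices : ∀ {n k} → Edge n k → Fin k → List (Fin n)
otherVertices e j = map (Vec.lookup e) (others j)

module _ {n k} {part : Fin n → Fin k} (e : Edge n k) (partite : ∀ i → part (Vec.lookup e i) ≡ i) where

  weight-otherVertices : ∀ (q : Fin k → ℕ) → (∀ i → 1 ≤ q i) →
                         (L : ListAssignment n) → (∀ u → length (L u) ≡ q (part u)) →
                         ∀ j → weight L (otherVertices e j) ≡ 1/ℕ (prodExcept q j)
  weight-otherVertices q 1≤q L |L|≡q j = begin-equality
    weight L (otherVertices e j)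
      ≡⟨ weight≡productℚ L (Unique.map⁺ lookup-injective (Unique.filter⁺ _ (allFin⁺ k))) ⟩
    productℚ (map (1/ℕ ∘ length ∘ L) (map (Vec.lookup e) (others j)))
      ≡⟨ cong productℚ (map-∘ (others j)) ⟨
    productℚ (map (1/ℕ ∘ length ∘ L ∘ Vec.lookup e) (others j))
      ≡⟨ cong productℚ (map-cong (λ i → cong 1/ℕ (trans (|L|≡q _) (cong q (partite i)))) (others j)) ⟩
    productℚ (map (1/ℕ ∘ q) (others j))
      ≡⟨ productℚ-1/ℕ q 1≤q (others j) ⟩
    1/ℕ (prodExcept q j)
      ∎
    where
    lookup-injective : ∀ {i i′} → Vec.lookup e i ≡ Vec.lookup e i′ → i ≡ i′
    lookup-injective {i} {i′} eq = trans (sym (partite i)) (trans (cong part eq) (partite i′))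

  Monochromatic-otherVertices : ∀ {L : ListAssignment n} (φ : ListColouring L) {v j c} → part v ≡ j →
    All (λ u → u ≡ v ⊎ colourOf L φ u ≡ c) (toList e) → Monochromatic L φ c (otherVertices e j)
  Monochromatic-otherVertices {L} φ {v} {j} {c} part-v blocks =
    map⁺ (All.map colour-c (all-filter (λ i → ¬? (i ≟ᶠ j)) (allFin k)))
    where
    colour-c : ∀ {i} → i ≢ j → colourOf L φ (Vec.lookup e i) ≡ c
    colour-c {i} i≢j with All.lookup blocks (∈-toList⁺ (∈-lookup i e))
    ... | inj₁ eᵢ≡v = ⊥-elim (i≢j (trans (sym (partite i)) (trans (cong part eᵢ≡v) part-v)))
    ... | inj₂ c≡   = c≡

badCount-≤ : ∀ {n k} (part : Fin n → Fin k) (edges : List (Edge n k)) → IsKPartite part edges →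
  (q : Fin k → ℕ) → (∀ i → 1 ≤ q i) → (L : ListAssignment n) → (∀ u → Unique (L u)) →
  (∀ u → length (L u) ≡ q (part u)) → ∀ {j v} → part v ≡ j →
  ℕ→ℚ (badCount edges L v)
    ≤ℚ ℕ→ℚ (totalCount L) * productℚ (map (λ c → 1ℚ - (1ℚ - 1/ℕ (prodExcept q j)) ^ℚ deg edges L v c) (L v))
badCount-≤ part edges partite q 1≤q L !L |L|≡q {j} {v} part-v =
  subst (λ b → ℕ→ℚ (badCount edges L v) ≤ℚ ℕ→ℚ (totalCount L) * b)
        (cong productℚ (map-cong (λ c → cong (1ℚ -_) (survival≡ c)) (L v)))
        (count-allBlocked-≤ L !L 1≤|L| (!L v) F (λ φ → length (Lφ edges L φ v) ℕ.≟ 0) allBlocked)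
  where
  1≤|L| : ∀ u → 1 ≤ length (L u)
  1≤|L| u = subst (1 ≤_) (sym (|L|≡q u)) (1≤q (part u))
  F : ℕ → List (List (Fin _))
  F c = map (λ e → otherVertices e j) (E edges L v c)
  partite-E : ∀ c → All (λ e → ∀ i → part (Vec.lookup e i) ≡ i) (E edges L v c)
  partite-E c = All.filter⁺ _ partite
  survival≡ : ∀ c → survivalBound L (F c) ≡ (1ℚ - 1/ℕ (prodExcept q j)) ^ℚ deg edges L v c
  survival≡ c = trans (cong productℚ (sym (map-∘ (E edges L v c))))
    (productℚ-const (All.map (λ {e} partite-e → cong (1ℚ -_) (weight-otherVertices e partite-e q 1≤q L |L|≡q j))
                             (partite-E c)))
  allBlocked : ∀ φ → length (Lφ edges L φ v) ≡ 0 → All (Blocked L F φ) (L v)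
  allBlocked φ ∅ =
    All.map blocked (length-filter-¬?≡0⇒All (λ c → Any.any? (Blocks? edges L φ v c) (E edges L v c)) (L v) ∅)
    where
    blocked : ∀ {c} → Any (λ e → All (λ u → u ≡ v ⊎ colourOf L φ u ≡ c) (toList e)) (E edges L v c) → Blocked L F φ c
    blocked {c} blocks with find blocks
    ... | e , e∈E , e-blocks =
      AnyP.map⁺ (lose e∈E (Monochromatic-otherVertices e (All.lookup (partite-E c) e∈E) {L} φ part-v e-blocks))

lemma4p1 : (k : ℕ) → 2 ≤ k →
    (n : ℕ) (part : Fin n → Fin k) (edges : List (Edge n k)) →
    Unique edges → IsKPartite part edges →
    (q : Fin k → ℕ) → (∀ i → 1 ≤ q i) →
    (L : ListAssignment n) → (∀ u → Unique (L u)) →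
    (∀ u → length (L u) ≡ q (part u)) →
    (j : Fin k) (v : Fin n) → part v ≡ j →
    -- Writing B = badCount/totalCount = P[L_φ(v) = ∅],
    -- P = ∏_{i≠j} q_i, D = Σ_{c ∈ L(v)} deg_H(v,c), a = (1 - 1/P)^D,
    -- the claim B ≤ (1 - a^{1/q_j})^{q_j} is stated as
    -- B^{1/q_j} + a^{1/q_j} ≤ 1, via all rational x, y ≥ 0 with
    -- x^{q_j} ≤ B and y^{q_j} ≤ a.
    ∀ (x y : ℚ) → 0ℚ ≤ℚ x → 0ℚ ≤ℚ y →
    (x ^ℚ q j) * ℕ→ℚ (totalCount L) ≤ℚ ℕ→ℚ (badCount edges L v) →
    (y ^ℚ q j) * (ℕ→ℚ (prodExcept q j) ^ℚ sum (map (deg edges L v) (L v)))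
      ≤ℚ ℕ→ℚ (prodExcept q j ∸ 1) ^ℚ sum (map (deg edges L v) (L v)) →
    x + y ≤ℚ 1ℚ
lemma4p1 k _ n part edges _ partite q 1≤q L !L |L|≡q j v part-v x y 0≤x 0≤y x^≤bad y^≤ =
  amgm-complementary (λ c → a ^ℚ d c) (L v) (λ c → ^ℚ-∈[0,1] (d c) a∈) (1≤|L| v) 0≤x 0≤y
    (subst (λ m → x ^ℚ m ≤ℚ productℚ (map (λ c → 1ℚ - a ^ℚ d c) (L v))) (sym |Lᵥ|≡qj)
      (p*r≤r*q⇒p≤q (0<ℕ→ℚ (1≤length-colourings L 1≤|L|))
        (≤-trans x^≤bad (badCount-≤ part edges partite q 1≤q L !L |L|≡q part-v))))
    (subst (λ m → y ^ℚ m ≤ℚ productℚ (map (λ c → a ^ℚ d c) (L v))) (sym |Lᵥ|≡qj)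
      (p*r≤r*q⇒p≤q (0<^ℚ D (0<ℕ→ℚ 1≤P))
        (≤-trans y^≤ (≤-reflexive (ℕ→ℚ[p∸1]^ℚ-sum 1≤P d (L v))))))
  where
  P = prodExcept q j
  a = 1ℚ - 1/ℕ P
  d = deg edges L v
  D = sum (map d (L v))
  |Lᵥ|≡qj : length (L v) ≡ q j
  |Lᵥ|≡qj = trans (|L|≡q v) (cong q part-v)
  1≤|L| : ∀ u → 1 ≤ length (L u)
  1≤|L| u = subst (1 ≤_) (sym (|L|≡q u)) (1≤q (part u))
  1≤P : 1 ≤ P
  1≤P = 1≤product q 1≤q (others j)
  a∈ : a ∈[0,1]
  a∈ = 1-∈[0,1] (0≤1/ℕ P , 1/ℕ≤1 P)
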